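{- Let $G$ be a $2$-connected graph which is contractible to a cactus $T$ (with a fixed $T$-witness structure), and let $T_B$ be the set of vertices $t$ of $T$ whose witness set $W(t)$ is big. Then there are at most $4\cdot|T_B|$ vertices of $T$ that lie on a path between two different vertices of $T_B$ and are adjacent to vertices of $T_B$.
   Context: A cactus is a connected graph in which every edge lies in at most one cycle. A graph $G$ is contractible to $T$ via a surjection $\psi:V(G)\to V(T)$ if for each $t\in V(T)$ the set $W(t)=\psi^{ -1}(t)$ induces a connected subgraph of $G$, and $t,t'$ are adjacent in $T$ iff some edge of $G$ joins $W(t)$ and $W(t')$; $\{W(t):t\in V(T)\}$ is the $T$-witness structure, and $W(t)$ is big if $|W(t)|\ge2$. -}

module Defs where

open import Data.Nat using (ℕ; _≤_)
open import Data.Fin using (Fin)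
open import Data.List using (List; []; _∷_; _++_; [_]; length; head; last)
open import Data.List.Relation.Unary.All using (All)
open import Data.List.Relation.Unary.Linked using (Linked)
open import Data.List.Relation.Unary.Unique.Propositional using (Unique)
open import Data.List.Membership.Propositional using (_∈_)
open import Data.Maybe using (just)
open import Data.Product using (Σ; ∃; ∃-syntax; _×_; _,_)
open import Data.Sum using (_⊎_)
open import Relation.Nullary using (¬_; Dec)
open import Relation.Binary.PropositionalEquality using (_≡_; _≢_)

record Graph : Set₁ where
  field
    n      : ℕ
    Adj    : Fin n → Fin n → Set
    sym    : ∀ {u v} → Adj u v → Adj v u
    irrefl : ∀ {u} → ¬ Adj u u
    dec    : ∀ u v → Dec (Adj u v)

open Graph public

V : Graph → Set
V G = Fin (n G)

IsWalk : (G : Graph) → V G → V G → List (V G) → Set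
IsWalk G u v ps = head ps ≡ just u × last ps ≡ just v × Linked (Adj G) ps

IsPath : (G : Graph) → V G → V G → List (V G) → Set
IsPath G u v ps = IsWalk G u v ps × Unique ps

InducesConnected : (G : Graph) → (V G → Set) → Set
InducesConnected G S =
  ∀ u v → S u → S v → ∃[ ps ] (IsWalk G u v ps × All S ps)

Connected : Graph → Set
Connected G = InducesConnected G (λ _ → ⊤')
  where
  open import Data.Unit using () renaming (⊤ to ⊤')

TwoConnected : Graph → Set
TwoConnected G = (3 ≤ n G) × (∀ x → InducesConnected G (λ v → v ≢ x))

record Cycle (G : Graph) : Set where
  field
    x    : V G
    xs   : List (V G)
    long : 2 ≤ length xs
    uniq : Unique (x ∷ xs)
    walk : Linked (Adj G) (x ∷ xs ++ [ x ])

closed : {G : Graph} → Cycle G → List (V G)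
closed C = Cycle.x C ∷ Cycle.xs C ++ [ Cycle.x C ]

EdgeOf : {G : Graph} → Cycle G → V G → V G → Set
EdgeOf {G} C u v = Consec u v ⊎ Consec v u
  where
  Consec : V G → V G → Set
  Consec a b = ∃[ pre ] ∃[ suf ] (closed C ≡ pre ++ a ∷ b ∷ suf)

SameCycle : {G : Graph} → Cycle G → Cycle G → Set
SameCycle C C' = ∀ a b → (EdgeOf C a b → EdgeOf C' a b) × (EdgeOf C' a b → EdgeOf C a b)

Cactus : Graph → Set
Cactus T = Connected T ×
  (∀ u v → Adj T u v → (C C' : Cycle T) → EdgeOf C u v → EdgeOf C' u v → SameCycle C C')

-- G is contractible to T via ψ (ψ defines the T-witness structure W(t) = ψ⁻¹(t)).
record ContractsVia (G T : Graph) (ψ : V G → V T) : Set where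
  field
    surj : ∀ t → ∃[ u ] (ψ u ≡ t)
    conn : ∀ t → InducesConnected G (λ u → ψ u ≡ t)
    adj→ : ∀ t t' → t ≢ t' → Adj T t t' → ∃[ u ] ∃[ v ] (ψ u ≡ t × ψ v ≡ t' × Adj G u v)
    adj← : ∀ t t' → t ≢ t' → (∃[ u ] ∃[ v ] (ψ u ≡ t × ψ v ≡ t' × Adj G u v)) → Adj T t t'

Big : (G T : Graph) → (V G → V T) → V T → Set
Big G T ψ t = ∃[ u ] ∃[ v ] (u ≢ v × ψ u ≡ t × ψ v ≡ t)

OnPathBetweenBig : (G T : Graph) → (V G → V T) → V T → Set
OnPathBetweenBig G T ψ t =
  ∃[ b₁ ] ∃[ b₂ ] (b₁ ≢ b₂ × Big G T ψ b₁ × Big G T ψ b₂ ×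
    ∃[ ps ] (IsPath T b₁ b₂ ps × t ∈ ps))

AdjToBig : (G T : Graph) → (V G → V T) → V T → Set
AdjToBig G T ψ t = ∃[ b ] (Big G T ψ b × Adj T t b)

{-# OPTIONS --safe #-}

-- If W(t) = {x} is a single vertex, walks of G − x project to walks of T − t, so T − t is
-- connected, and in the cactus T this leaves t with at most two neighbours. Hence a run of
-- small vertices leaving a big vertex v along an edge vw is determined by that edge up to the
-- first big vertex u it meets. Fix a root ρ. One end of such a run, say u, reaches ρ avoiding
-- the other end v, and by the cactus property again v has at most two neighbours w that reach
-- ρ avoiding v. A counted vertex t is the first or the last vertex strictly between the ends
-- of such a run (for small t one of its neighbours on the path is big; for big t the run is a
-- single edge), so t ↦ (v, w, first or last) is injective with at most 4 |T_B| values.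

module Submission where

open import Defs
open import Data.Nat using (_≤_; _*_)
open import Data.List using (List; length)
open import Data.List.Relation.Unary.All using (All)
open import Data.List.Relation.Unary.Unique.Propositional using (Unique)
open import Data.List.Membership.Propositional using (_∈_)
open import Data.Product using (_×_)

open import Data.Bool using (Bool; true; false; if_then_else_)
open import Data.Empty using (⊥-elim)
open import Data.Fin using (Fin; zero; suc; fromℕ<) renaming (_≟_ to _≟ᶠ_)
open import Data.Fin.Properties using (injective⇒≤) renaming (any? to any?ᶠ)
open import Data.List using ([]; _∷_; _++_; [_]; _ʳ++_; reverse; lookup; head; last)
open import Data.List.Properties
  using (∷-injective; ∷ʳ-injective; ++-assoc; ++-conicalʳ; ʳ++-defn; reverse-involutive)
open import Data.List.Relation.Unary.All as All using ([]; _∷_; reduce)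
open import Data.List.Relation.Unary.All.Properties using (¬Any⇒All¬; ++⁻ʳ)
open import Data.List.Relation.Unary.Any as Any using (Any; here; there)
open import Data.List.Relation.Unary.Any.Properties using (lookup-index) renaming (reverse⁺ to Any-reverse⁺)
open import Data.List.Relation.Unary.AllPairs as AllPairs using ([]; _∷_)
open import Data.List.Relation.Unary.Linked as Linked using (Linked; [-]; _∷_)
open import Data.List.Relation.Binary.Disjoint.Propositional using (Disjoint)
open import Data.List.Relation.Binary.Subset.Propositional using (_⊆_)
open import Data.List.Membership.Propositional using (_∉_; find; lose)
open import Data.List.Membership.Propositional.Properties using (∈-lookup; ∈-∃++; ∈-++⁺ˡ; ∈-++⁺ʳ)
open import Data.Maybe using (just)
open import Data.Maybe.Properties using (just-injective)
open import Data.Nat as ℕ using (_+_; z≤n; s≤s)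
open import Data.Nat.Properties using (≤-trans; *-suc; module ≤-Reasoning)
open import Data.Product using (Σ; Σ-syntax; ∃; ∃₂; ∃-syntax; _,_; proj₁; proj₂; swap)
open import Data.Sum using (_⊎_; inj₁; inj₂)
open import Function using (_∘_; case_of_)
open import Relation.Binary.Definitions using (DecidableEquality; Symmetric)
open import Relation.Binary.PropositionalEquality as ≡ using (_≡_; _≢_; refl; cong; subst; ≢-sym)
open import Relation.Nullary using (¬_; yes; no)
open import Relation.Nullary.Decidable using (_×-dec_; ¬?; decidable-stable)
open import Relation.Unary using (Decidable)

AtMostTwo : {A : Set} → (A → Set) → Set
AtMostTwo P = ∀ {x y z} → P x → P y → P z → x ≢ y → x ≢ z → y ≡ z

module _ {A : Set} where

  Unique-lookup-injective : ∀ {xs : List A} → Unique xs →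
                            ∀ {i j} → lookup xs i ≡ lookup xs j → i ≡ j
  Unique-lookup-injective (_ ∷ _)  {zero}  {zero}  _  = refl
  Unique-lookup-injective (x≢ ∷ _) {zero}  {suc j} eq = ⊥-elim (All.lookup x≢ (∈-lookup j) eq)
  Unique-lookup-injective (x≢ ∷ _) {suc i} {zero}  eq = ⊥-elim (All.lookup x≢ (∈-lookup i) (≡.sym eq))
  Unique-lookup-injective (_ ∷ u)  {suc i} {suc j} eq = cong suc (Unique-lookup-injective u eq)

  Unique-⊆⇒length≤ : ∀ {xs ys : List A} → Unique xs → xs ⊆ ys → length xs ≤ length ys
  Unique-⊆⇒length≤ {xs} {ys} u xs⊆ys = injective⇒≤ {f = position} position-injective
    where
    position : Fin (length xs) → Fin (length ys)
    position i = Any.index (xs⊆ys (∈-lookup i))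

    position-injective : ∀ {i j} → position i ≡ position j → i ≡ j
    position-injective {i} {j} eq = Unique-lookup-injective u (begin
      lookup xs i            ≡⟨ lookup-index (xs⊆ys (∈-lookup i)) ⟩
      lookup ys (position i) ≡⟨ cong (lookup ys) eq ⟩
      lookup ys (position j) ≡⟨ ≡.sym (lookup-index (xs⊆ys (∈-lookup j))) ⟩
      lookup xs j            ∎)
      where open ≡.≡-Reasoning

  Unique-++⁻ʳ : ∀ (xs : List A) {ys} → Unique (xs ++ ys) → Unique ys
  Unique-++⁻ʳ []       u       = u
  Unique-++⁻ʳ (_ ∷ xs) (_ ∷ u) = Unique-++⁻ʳ xs u

  ∉-∷ʳ-split : ∀ {v : A} xs pre {suf} → v ∉ xs →
               xs ++ [ v ] ≡ pre ++ v ∷ suf → xs ≡ pre × suf ≡ []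
  ∉-∷ʳ-split []       []        _  eq = refl , ≡.sym (proj₂ (∷-injective eq))
  ∉-∷ʳ-split []       (_ ∷ pre) _  eq with ++-conicalʳ pre _ (≡.sym (proj₂ (∷-injective eq)))
  ... | ()
  ∉-∷ʳ-split (_ ∷ _)  []        v∉ eq = ⊥-elim (v∉ (here (≡.sym (proj₁ (∷-injective eq)))))
  ∉-∷ʳ-split (x ∷ xs) (_ ∷ pre) v∉ eq with ∷-injective eq
  ... | refl , eq′ with ∉-∷ʳ-split xs pre (v∉ ∘ there) eq′
  ...   | xs≡pre , suf≡[] = cong (x ∷_) xs≡pre , suf≡[]

  head-split : ∀ pre {t post} {b : A} → head (pre ++ t ∷ post) ≡ just b → b ≡ t ⊎ b ∈ pre
  head-split []      eq = inj₁ (≡.sym (just-injective eq))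
  head-split (_ ∷ _) eq = inj₂ (here (≡.sym (just-injective eq)))

  last-∈ : ∀ xs {x : A} → last xs ≡ just x → x ∈ xs
  last-∈ []           ()
  last-∈ (_ ∷ [])     eq = here (≡.sym (just-injective eq))
  last-∈ (_ ∷ y ∷ ys) eq = there (last-∈ (y ∷ ys) eq)

  last-split : ∀ pre {t post} {b : A} → last (pre ++ t ∷ post) ≡ just b → b ≡ t ⊎ b ∈ post
  last-split []            {post = []}    eq = inj₁ (≡.sym (just-injective eq))
  last-split []            {post = _ ∷ _} eq = inj₂ (last-∈ _ eq)
  last-split (_ ∷ [])      eq = last-split [] eq
  last-split (_ ∷ y ∷ pre) eq = last-split (y ∷ pre) eq

  Linked-ʳ++⁻ : ∀ {R : A → A → Set} → Symmetric R → ∀ xs {t ys} →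
                Linked R (xs ʳ++ t ∷ ys) → Linked R (t ∷ xs) × Linked R (t ∷ ys)
  Linked-ʳ++⁻ sym []       l = [-] , l
  Linked-ʳ++⁻ sym (x ∷ xs) l with Linked-ʳ++⁻ sym xs l
  ... | lx , (r ∷ l′) = sym r ∷ lx , l′

  Unique-ʳ++⁻ : ∀ (xs : List A) {t ys} → Unique (xs ʳ++ t ∷ ys) →
                Unique (t ∷ xs) × Unique (t ∷ ys) × Disjoint xs ys
  Unique-ʳ++⁻ []       u = ([] ∷ []) , u , λ ()
  Unique-ʳ++⁻ (x ∷ xs) {t} {ys} u with Unique-ʳ++⁻ xs u
  ... | ux , ((x≢t ∷ x≢ys) ∷ uys) , xs#tys = (≢-sym x≢t ∷ t≢xs) ∷ ux , uys , x∷xs#ys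
    where
    t≢xs : All (t ≢_) xs
    t≢xs = All.tabulate λ z∈xs t≡z → xs#tys (z∈xs , here (≡.sym t≡z))
    x∷xs#ys : Disjoint (x ∷ xs) ys
    x∷xs#ys (here refl , z∈ys)  = All.lookup x≢ys z∈ys refl
    x∷xs#ys (there z∈xs , z∈ys) = xs#tys (z∈xs , there z∈ys)

  search : ∀ {P : A → Set} → Decidable P → ∀ xs →
           (∃ λ x → x ∈ xs × P x) ⊎ (∀ {x} → x ∈ xs → ¬ P x)
  search P? xs with Any.any? P? xs
  ... | yes p = inj₁ (find p)
  ... | no ¬p = inj₂ λ x∈xs px → ¬p (lose x∈xs px)

module _ {A B : Set} {P : A → Set} (f : ∀ {x} → P x → B) where

  length-reduce : ∀ {xs} (ps : All P xs) → length (reduce f ps) ≡ length xs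
  length-reduce []       = refl
  length-reduce (_ ∷ ps) = cong ℕ.suc (length-reduce ps)

  All-reduce : ∀ {Q : B → Set} → (∀ {x} (p : P x) → Q (f p)) →
               ∀ {xs} (ps : All P xs) → All Q (reduce f ps)
  All-reduce q []       = []
  All-reduce q (p ∷ ps) = q p ∷ All-reduce q ps

  Unique-reduce : (∀ {x y} (p : P x) (q : P y) → f p ≡ f q → x ≡ y) →
                  ∀ {xs} → Unique xs → (ps : All P xs) → Unique (reduce f ps)
  Unique-reduce inj []         []       = []
  Unique-reduce inj (x≢xs ∷ u) (p ∷ ps) = fresh x≢xs ps ∷ Unique-reduce inj u ps
    where
    fresh : ∀ {ys} → All (_ ≢_) ys → (qs : All P ys) → All (f p ≢_) (reduce f qs)
    fresh []           []       = []
    fresh (x≢y ∷ x≢ys) (q ∷ qs) = (x≢y ∘ inj p q) ∷ fresh x≢ys qs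

Admissible : {A : Set} → (A → A → Set) → List A → A × A × Bool → Set
Admissible Arm B (v , w , _) = v ∈ B × Arm v w

quad : {A : Set} → A → A × A → List (A × A × Bool)
quad v (w₁ , w₂) = (v , w₁ , true) ∷ (v , w₁ , false) ∷ (v , w₂ , true) ∷ (v , w₂ , false) ∷ []

∈-quad : ∀ {A : Set} {v w w₁ w₂ : A} b → w ≡ w₁ ⊎ w ≡ w₂ → (v , w , b) ∈ quad v (w₁ , w₂)
∈-quad true  (inj₁ refl) = here refl
∈-quad false (inj₁ refl) = there (here refl)
∈-quad true  (inj₂ refl) = there (there (here refl))
∈-quad false (inj₂ refl) = there (there (there (here refl)))

module _ {A : Set} (arms : A → A × A) where

  candidates : List A → List (A × A × Bool)
  candidates []      = []
  candidates (v ∷ B) = quad v (arms v) ++ candidates B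

  length-candidates : ∀ B → length (candidates B) ≡ 4 * length B
  length-candidates []      = refl
  length-candidates (v ∷ B) = ≡.trans (cong (4 +_) (length-candidates B)) (≡.sym (*-suc 4 (length B)))

  ∈-candidates : ∀ {v k B} → v ∈ B → k ∈ quad v (arms v) → k ∈ candidates B
  ∈-candidates             (here refl) k∈ = ∈-++⁺ˡ k∈
  ∈-candidates {B = v ∷ _} (there v∈B) k∈ = ∈-++⁺ʳ (quad v (arms v)) (∈-candidates v∈B k∈)

module _ {A : Set} (_≟_ : DecidableEquality A) {Arm : A → A → Set}
         (atMostTwo : ∀ {v} → AtMostTwo (Arm v)) {B : List A} {K : List (A × A × Bool)}
         (admissible : All (Admissible Arm B) K) where

  private
    arm : ∀ {v w b} → (v , w , b) ∈ K → Arm v w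
    arm k∈K = proj₂ (All.lookup admissible k∈K)

  armsCover : ∀ v → Σ (A × A) λ ws →
              ∀ {w b} → (v , w , b) ∈ K → w ≡ proj₁ ws ⊎ w ≡ proj₂ ws
  armsCover v with search (λ k → proj₁ k ≟ v) K
  ... | inj₂ none = (v , v) , λ k∈K → ⊥-elim (none k∈K refl)
  ... | inj₁ ((_ , w₁ , _) , k₁∈K , refl)
    with search (λ k → proj₁ k ≟ v ×-dec ¬? (proj₁ (proj₂ k) ≟ w₁)) K
  ...   | inj₂ none = (w₁ , w₁) , λ {w} k∈K →
          inj₁ (decidable-stable (w ≟ w₁) λ w≢w₁ → none k∈K (refl , w≢w₁))
  ...   | inj₁ ((_ , w₂ , _) , k₂∈K , refl , w₂≢w₁) =
          (w₁ , w₂) , λ {w} k∈K → case w ≟ w₁ of λ where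
            (yes w≡w₁) → inj₁ w≡w₁
            (no w≢w₁)  → inj₂ (≡.sym (atMostTwo (arm k₁∈K) (arm k₂∈K) (arm k∈K)
                                                (≢-sym w₂≢w₁) (≢-sym w≢w₁)))

  length≤4*length : Unique K → length K ≤ 4 * length B
  length≤4*length uK = begin
    length K                ≤⟨ Unique-⊆⇒length≤ uK K⊆candidates ⟩
    length (candidates _ B) ≡⟨ length-candidates _ B ⟩
    4 * length B            ∎
    where
    open ≤-Reasoning
    K⊆candidates : K ⊆ candidates (proj₁ ∘ armsCover) B
    K⊆candidates {v , w , b} k∈K =
      ∈-candidates _ (proj₁ (All.lookup admissible k∈K)) (∈-quad b (proj₂ (armsCover v) k∈K))

module _ (H : Graph) where

  data WalkIn (P : V H → Set) : V H → V H → Set where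
    stop : ∀ {x} → P x → WalkIn P x x
    step : ∀ {x y z} → P x → Adj H x y → WalkIn P y z → WalkIn P x z

module _ {H : Graph} where

  open import Data.List.Membership.DecPropositional (_≟ᶠ_ {n H}) using (_∈?_)

  adj⇒≢ : ∀ {x y} → Adj H x y → x ≢ y
  adj⇒≢ e refl = irrefl H e

  module _ {P : V H → Set} where

    verts : ∀ {x y} → WalkIn H P x y → List (V H)
    later : ∀ {x y} → WalkIn H P x y → List (V H)
    verts {x} w = x ∷ later w
    later (stop _)     = []
    later (step _ _ w) = verts w

    atSource : ∀ {x y} → WalkIn H P x y → P x
    atSource (stop p)     = p
    atSource (step p _ _) = p

    verts-All : ∀ {x y} (w : WalkIn H P x y) → All P (verts w)
    verts-All (stop p)     = p ∷ []
    verts-All (step p _ w) = p ∷ verts-All w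

    restrict : ∀ {Q x y} (w : WalkIn H P x y) → All Q (verts w) → WalkIn H Q x y
    restrict (stop _)     (q ∷ [])  = stop q
    restrict (step _ e w) (q ∷ qs) = step q e (restrict w qs)

    _++ʷ_ : ∀ {x y z} → WalkIn H P x y → WalkIn H P y z → WalkIn H P x z
    stop _     ++ʷ w′ = w′
    step p e w ++ʷ w′ = step p e (w ++ʷ w′)

    reverseʷ : ∀ {x y} → WalkIn H P x y → WalkIn H P y x
    reverseʷ (stop p)     = stop p
    reverseʷ (step p e w) = reverseʷ w ++ʷ step (atSource w) (sym H e) (stop p)

    fromIsWalk : ∀ {a b ps} → IsWalk H a b ps → All P ps → WalkIn H P a b
    fromIsWalk {ps = _ ∷ []}    (refl , refl , _)     (p ∷ []) = stop p
    fromIsWalk {ps = _ ∷ _ ∷ _} (refl , last≡ , e ∷ l) (p ∷ ps) =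
      step p e (fromIsWalk (refl , last≡ , l) ps)

    verts-∷ʳ : ∀ {x y} (w : WalkIn H P x y) → ∃[ pre ] verts w ≡ pre ++ [ y ]
    verts-∷ʳ (stop _) = [] , refl
    verts-∷ʳ (step {x} _ _ w) with verts-∷ʳ w
    ... | pre , eq = x ∷ pre , cong (x ∷_) eq

    Linked-verts-∷ʳ : ∀ {x y z} (w : WalkIn H P x y) → Adj H y z → Linked (Adj H) (verts w ++ [ z ])
    Linked-verts-∷ʳ (stop _)      e = e ∷ [-]
    Linked-verts-∷ʳ (step _ e′ w) e = e′ ∷ Linked-verts-∷ʳ w e

    suffixAt : ∀ {x y z} (w : WalkIn H P x y) → z ∈ verts w →
               Σ[ q ∈ WalkIn H P z y ] ∃[ pre ] verts w ≡ pre ++ verts q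
    suffixAt w                (here refl) = w , [] , refl
    suffixAt (step {x} _ _ w) (there z∈)  with suffixAt w z∈
    ... | q , pre , eq = q , x ∷ pre , cong (x ∷_) eq

    toPath : ∀ {x y} → WalkIn H P x y → Σ[ π ∈ WalkIn H P x y ] Unique (verts π)
    toPath (stop p) = stop p , [] ∷ []
    toPath (step {x} p e w) with toPath w
    ... | π , uπ with x ∈? verts π
    ...   | yes x∈π = let q , pre , eq = suffixAt π x∈π in q , Unique-++⁻ʳ pre (subst Unique eq uπ)
    ...   | no x∉π  = step p e π , ¬Any⇒All¬ _ x∉π ∷ uπ

Arm : (H : Graph) → V H → V H → V H → Set
Arm H r v w = Adj H v w × WalkIn H (v ≢_) w r

module _ {H : Graph} where

  open import Data.List.Membership.DecPropositional (_≟ᶠ_ {n H}) using (_∈?_)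

  cycleThrough : ∀ {v x y} → Adj H v x → Adj H v y → x ≢ y → WalkIn H (v ≢_) x y →
                 Σ[ C ∈ Cycle H ] EdgeOf C v x × EdgeOf C v y × (∀ {z} → EdgeOf C v z → z ≡ x ⊎ z ≡ y)
  cycleThrough {v} {x} {y} vx vy x≢y w with toPath w
  ... | stop _ , _ = ⊥-elim (x≢y refl)
  ... | π@(step v≢x _ _) , uπ = C , inj₁ ([] , _ , refl) , last-edge , only-edges
    where
    v∉π : v ∉ verts π
    v∉π v∈π = All.lookup (verts-All π) v∈π refl

    C : Cycle H
    C = record { x = v ; xs = verts π ; long = s≤s (s≤s z≤n)
               ; uniq = verts-All π ∷ uπ ; walk = vx ∷ Linked-verts-∷ʳ π (sym H vy) }

    last-edge : EdgeOf C v y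
    last-edge with verts-∷ʳ π
    ... | pre , eq =
      inj₂ (v ∷ pre , [] , cong (v ∷_) (≡.trans (cong (_++ [ v ]) eq) (++-assoc pre [ y ] [ v ])))

    only-edges : ∀ {z} → EdgeOf C v z → z ≡ x ⊎ z ≡ y
    only-edges (inj₁ ([] , _ , eq)) = inj₁ (≡.sym (proj₁ (∷-injective (proj₂ (∷-injective eq)))))
    only-edges (inj₁ (_ ∷ pre , _ , eq)) with ∉-∷ʳ-split (verts π) pre v∉π (proj₂ (∷-injective eq))
    ... | _ , ()
    only-edges (inj₂ ([] , _ , eq)) = ⊥-elim (v≢x (≡.sym (proj₁ (∷-injective (proj₂ (∷-injective eq))))))
    only-edges (inj₂ (_ ∷ pre , suf , eq))
      with ∉-∷ʳ-split (verts π) (pre ++ [ _ ]) v∉π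
             (≡.trans (proj₂ (∷-injective eq)) (≡.sym (++-assoc pre [ _ ] (v ∷ suf))))
    ... | π≡pre∷ʳz , _ with verts-∷ʳ π
    ...   | pre′ , π≡pre′∷ʳy =
      inj₂ (≡.sym (proj₂ (∷ʳ-injective pre′ pre (≡.trans (≡.sym π≡pre′∷ʳy) π≡pre∷ʳz))))

  -- The cycles v x … y v and v x … z v share the edge vx, so they coincide and vz lies on the first.
  cactus⇒atMostTwoArms : Cactus H → ∀ {r v} → AtMostTwo (Arm H r v)
  cactus⇒atMostTwoArms (_ , oneCycle) {v = v} (vx , wx) (vy , wy) (vz , wz) x≢y x≢z
    with cycleThrough vx vy x≢y (wx ++ʷ reverseʷ wy) | cycleThrough vx vz x≢z (wx ++ʷ reverseʷ wz)
  ... | Cxy , vx∈Cxy , _ , only-x-y | Cxz , vx∈Cxz , vz∈Cxz , _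
    with only-x-y (proj₂ (oneCycle v _ vx Cxy Cxz vx∈Cxy vx∈Cxz v _) vz∈Cxz)
  ... | inj₁ z≡x = ⊥-elim (x≢z (≡.sym z≡x))
  ... | inj₂ z≡y = ≡.sym z≡y

  -- If v lies on a path from u to r, the part of the path after v avoids u.
  connected⇒orient : Connected H → ∀ r {u v} → u ≢ v → WalkIn H (v ≢_) u r ⊎ WalkIn H (u ≢_) v r
  connected⇒orient connected r {u} {v} u≢v with connected u r _ _
  ... | _ , isWalk , all with toPath (fromIsWalk isWalk all)
  ... | π , uπ = orientPath π uπ
    where
    orientPath : ∀ {P} (π : WalkIn H P u r) → Unique (verts π) → WalkIn H (v ≢_) u r ⊎ WalkIn H (u ≢_) v r
    orientPath π uπ with v ∈? verts π
    ... | no v∉π           = inj₁ (restrict π (¬Any⇒All¬ _ v∉π))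
    ... | yes (here v≡u)   = ⊥-elim (u≢v (≡.sym v≡u))
    orientPath (step _ _ π′) (u∉π′ ∷ _) | yes (there v∈π′) with suffixAt π′ v∈π′
    ... | q , pre , eq = inj₂ (restrict q (++⁻ʳ pre (subst (All (u ≢_)) eq u∉π′)))

Small : (G T : Graph) → (V G → V T) → V T → Set
Small G T ψ t = ¬ Big G T ψ t

module _ {G T : Graph} {ψ : V G → V T} where

  Big? : Decidable (Big G T ψ)
  Big? t = any?ᶠ λ x → any?ᶠ λ y → ¬? (x ≟ᶠ y) ×-dec ψ x ≟ᶠ t ×-dec ψ y ≟ᶠ t

  small-fibre : ∀ {t x y} → Small G T ψ t → ψ x ≡ t → ψ y ≡ t → x ≡ y
  small-fibre {x = x} {y} small ψx≡t ψy≡t with x ≟ᶠ y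
  ... | yes x≡y = x≡y
  ... | no x≢y  = ⊥-elim (small (x , y , x≢y , ψx≡t , ψy≡t))

  project : ContractsVia G T ψ → ∀ {P a b} → WalkIn G (P ∘ ψ) a b → WalkIn T P (ψ a) (ψ b)
  project con (stop p) = stop p
  project con {P} {b = b} (step {x} {y} p e w) with ψ x ≟ᶠ ψ y
  ... | yes ψx≡ψy = subst (λ s → WalkIn T P s (ψ b)) (≡.sym ψx≡ψy) (project con w)
  ... | no ψx≢ψy  =
    step p (ContractsVia.adj← con (ψ x) (ψ y) ψx≢ψy (x , y , refl , refl , e)) (project con w)

  small⇒connected : TwoConnected G → ContractsVia G T ψ → ∀ {t a b} → Small G T ψ t →
                    t ≢ a → t ≢ b → WalkIn T (t ≢_) a b
  small⇒connected (_ , connected-without) con {t} {a} {b} small t≢a t≢b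
    with ContractsVia.surj con t | ContractsVia.surj con a | ContractsVia.surj con b
  ... | x , refl | a′ , refl | b′ , refl
    with connected-without x a′ b′ (t≢a ∘ cong ψ ∘ ≡.sym) (t≢b ∘ cong ψ ∘ ≡.sym)
  ... | _ , isWalk , avoids-x = project con {P = ψ x ≢_} (fromIsWalk isWalk (All.map image-avoids avoids-x))
    where
    image-avoids : ∀ {y} → y ≢ x → ψ x ≢ ψ y
    image-avoids y≢x ψx≡ψy = y≢x (small-fibre small (≡.sym ψx≡ψy) refl)

  small⇒atMostTwoNeighbours : TwoConnected G → Cactus T → ContractsVia G T ψ →
                              ∀ {t} → Small G T ψ t → AtMostTwo (Adj T t)
  small⇒atMostTwoNeighbours tc cactus con {t} small {x} tx ty tz =
    cactus⇒atMostTwoArms cactus (tx , stop (adj⇒≢ {T} tx)) (ty , towards-x ty) (tz , towards-x tz)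
    where
    towards-x : ∀ {y} → Adj T t y → WalkIn T (t ≢_) y x
    towards-x ty = small⇒connected tc con small (adj⇒≢ {T} ty) (adj⇒≢ {T} tx)

module Charging (G T : Graph) (ψ : V G → V T) (tc : TwoConnected G) (cactus : Cactus T)
                (con : ContractsVia G T ψ) (ρ : V T) where

  small-degree≤2 : ∀ {t} → Small G T ψ t → AtMostTwo (Adj T t)
  small-degree≤2 = small⇒atMostTwoNeighbours tc cactus con

  big? : Decidable (Big G T ψ)
  big? = Big? {G} {T} {ψ}

  -- Run p x u: the walk x, …, u entered from p, through small vertices up to the first big
  -- vertex u, never returning to the vertex it has just left.
  data Run (p : V T) : V T → V T → Set where
    arrive : ∀ {x} → Big G T ψ x → Run p x x
    pass   : ∀ {x y u} → Small G T ψ x → Adj T x y → p ≢ y → Run x y u → Run p x u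

  penultimate : ∀ {p x u} → Run p x u → V T
  penultimate {p} (arrive _)     = p
  penultimate     (pass _ _ _ r) = penultimate r

  arrival-big : ∀ {p x u} → Run p x u → Big G T ψ u
  arrival-big (arrive bx)     = bx
  arrival-big (pass _ _ _ r) = arrival-big r

  penultimate-adj : ∀ {p x u} → Adj T p x → (r : Run p x u) → Adj T (penultimate r) u
  penultimate-adj px (arrive _)      = px
  penultimate-adj _  (pass _ xy _ r) = penultimate-adj xy r

  penultimate-unique : ∀ {p x u u′} → Adj T x p → (r : Run p x u) (r′ : Run p x u′) →
                       penultimate r ≡ penultimate r′
  penultimate-unique _  (arrive _)          (arrive _)          = refl
  penultimate-unique _  (arrive bx)         (pass sx _ _ _)     = ⊥-elim (sx bx)
  penultimate-unique _  (pass sx _ _ _)     (arrive bx)         = ⊥-elim (sx bx)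
  penultimate-unique xp (pass sx xy p≢y r) (pass _ xy′ p≢y′ r′)
    with small-degree≤2 sx xp xy xy′ p≢y p≢y′
  ... | refl = penultimate-unique (sym T xy) r r′

  reverseOnto : ∀ {p x u v} (r : Run p x u) → Adj T x p → Run x p v → Run u (penultimate r) v
  reverseOnto (arrive _)          _  acc = acc
  reverseOnto (pass sx xy p≢y r) xp acc = reverseOnto r (sym T xy) (pass sx xp (≢-sym p≢y) acc)

  penultimate-reverseOnto : ∀ {p x u v} (r : Run p x u) (xp : Adj T x p) (acc : Run x p v) →
                            penultimate (reverseOnto r xp acc) ≡ penultimate acc
  penultimate-reverseOnto (arrive _)          _  _   = refl
  penultimate-reverseOnto (pass sx xy p≢y r) xp acc =
    penultimate-reverseOnto r (sym T xy) (pass sx xp (≢-sym p≢y) acc)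

  runWalk : ∀ {v p x u} → Big G T ψ v → v ≢ u → Run p x u → WalkIn T (v ≢_) x u
  runWalk _  v≢u (arrive _)       = stop v≢u
  runWalk bv v≢u (pass sx xy _ r) = step (λ { refl → sx bv }) xy (runWalk bv v≢u r)

  record Charge (t : V T) : Set where
    constructor charge
    field
      v w u   : V T
      big     : Big G T ψ v
      edge    : Adj T v w
      run     : Run v w u
      v≢u     : v ≢ u
      descent : WalkIn T (v ≢_) u ρ
      near    : Bool
      at      : t ≡ (if near then w else penultimate run)

  key : ∀ {t} → Charge t → V T × V T × Bool
  key c = Charge.v c , Charge.w c , Charge.near c

  arm : ∀ {t} (c : Charge t) → Arm T ρ (Charge.v c) (Charge.w c)
  arm c = edge , runWalk big v≢u run ++ʷ descent
    where open Charge c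

  key-injective : ∀ {t t′} (c : Charge t) (c′ : Charge t′) → key c ≡ key c′ → t ≡ t′
  key-injective (charge _ _ _ _ _  _ _ _ true  t≡w)   (charge _ _ _ _ _ _  _ _ _ t′≡w)   refl =
    ≡.trans t≡w (≡.sym t′≡w)
  key-injective (charge _ _ _ _ vw r _ _ false t≡pen) (charge _ _ _ _ _ r′ _ _ _ t′≡pen) refl =
    ≡.trans t≡pen (≡.trans (penultimate-unique (sym T vw) r r′) (≡.sym t′≡pen))

  chargeFirst : ∀ {v t u} → Big G T ψ v → Adj T v t → Run v t u → v ≢ u → Charge t
  chargeFirst {v} {t} {u} bv vt r v≢u with connected⇒orient (proj₁ cactus) ρ (≢-sym v≢u)
  ... | inj₁ u↝ρ = charge v t u bv vt r v≢u u↝ρ true refl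
  ... | inj₂ v↝ρ = charge u (penultimate r) v (arrival-big r) (sym T (penultimate-adj vt r))
                     (reverseOnto r (sym T vt) (arrive bv)) (≢-sym v≢u) v↝ρ false
                     (≡.sym (penultimate-reverseOnto r (sym T vt) (arrive bv)))

  runAlong : ∀ {p t} xs → Linked (Adj T) (p ∷ t ∷ xs) → Unique (p ∷ t ∷ xs) →
             Any (Big G T ψ) (t ∷ xs) → ∃[ u ] u ∈ t ∷ xs × Run p t u
  runAlong {t = t} xs l u big with big? t
  ... | yes bt = t , here refl , arrive bt
  runAlong [] _ _ big | no st with Any.tail st big
  ... | ()
  runAlong (_ ∷ ys) (_ ∷ l) ((_ ∷ p≢y ∷ _) ∷ u) big | no st with runAlong ys l u (Any.tail st big)
  ... | w , w∈ , r = w , there w∈ , pass st (Linked.head l) p≢y r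

  -- A path through t seen from t: each side is listed starting next to t.
  record Through (t : V T) (left right : List (V T)) : Set where
    field
      linkedˡ  : Linked (Adj T) (t ∷ left)
      linkedʳ  : Linked (Adj T) (t ∷ right)
      uniqueˡ  : Unique (t ∷ left)
      uniqueʳ  : Unique (t ∷ right)
      disjoint : Disjoint left right
      bigˡ     : Any (Big G T ψ) left
      bigʳ     : Any (Big G T ψ) right

  swapSides : ∀ {t l r} → Through t l r → Through t r l
  swapSides th = record
    { linkedˡ = linkedʳ ; linkedʳ = linkedˡ ; uniqueˡ = uniqueʳ ; uniqueʳ = uniqueˡ
    ; disjoint = disjoint ∘ swap ; bigˡ = bigʳ ; bigʳ = bigˡ }
    where open Through th

  chargeFromLeft : ∀ {t p l r} → Through t (p ∷ l) r → Big G T ψ p → Charge t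
  chargeFromLeft {t} {p} {l} {r} th bp =
    let u , u∈ , run = runAlong r (sym T tp ∷ linkedʳ) (p-fresh ∷ uniqueʳ) (there bigʳ)
    in chargeFirst bp (sym T tp) run (All.lookup p-fresh u∈)
    where
    open Through th
    tp : Adj T t p
    tp = Linked.head linkedˡ
    p-fresh : All (p ≢_) (t ∷ r)
    p-fresh = ≢-sym (All.head (AllPairs.head uniqueˡ)) ∷ ¬Any⇒All¬ r λ p∈r → disjoint (here refl , p∈r)

  pathThrough : ∀ {b₁ b₂ ps t} → IsPath T b₁ b₂ ps → Big G T ψ b₁ → Big G T ψ b₂ →
                Small G T ψ t → t ∈ ps → ∃₂ (Through t)
  pathThrough {b₁} {b₂} {t = t} ((head≡ , last≡ , linked) , unique) bb₁ bb₂ st t∈ps with ∈-∃++ t∈ps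
  ... | pre , post , refl = reverse pre , post , record
    { linkedˡ = proj₁ linked-sides ; linkedʳ = proj₂ linked-sides
    ; uniqueˡ = proj₁ unique-sides ; uniqueʳ = proj₁ (proj₂ unique-sides)
    ; disjoint = proj₂ (proj₂ unique-sides)
    ; bigˡ = Any-reverse⁺ (big-side (head-split pre head≡) bb₁)
    ; bigʳ = big-side (last-split pre last≡) bb₂ }
    where
    zipper : pre ++ t ∷ post ≡ reverse pre ʳ++ t ∷ post
    zipper = ≡.sym (≡.trans (ʳ++-defn (reverse pre)) (cong (_++ t ∷ post) (reverse-involutive pre)))

    linked-sides : Linked (Adj T) (t ∷ reverse pre) × Linked (Adj T) (t ∷ post)
    linked-sides = Linked-ʳ++⁻ (sym T) (reverse pre) (subst (Linked (Adj T)) zipper linked)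
    unique-sides : Unique (t ∷ reverse pre) × Unique (t ∷ post) × Disjoint (reverse pre) post
    unique-sides = Unique-ʳ++⁻ (reverse pre) (subst Unique zipper unique)

    big-side : ∀ {b xs} → b ≡ t ⊎ b ∈ xs → Big G T ψ b → Any (Big G T ψ) xs
    big-side (inj₁ refl) bb = ⊥-elim (st bb)
    big-side (inj₂ b∈xs) bb = lose b∈xs bb

  smallCharge : ∀ {t b l r} → Small G T ψ t → Big G T ψ b → Adj T t b → Through t l r → Charge t
  smallCharge {l = []}    _ _ _ th with Through.bigˡ th
  ... | ()
  smallCharge {r = []}    _ _ _ th with Through.bigʳ th
  ... | ()
  smallCharge {b = b} {p ∷ _} {y ∷ _} st bb tb th with b ≟ᶠ p
  ... | yes refl = chargeFromLeft th bb
  ... | no b≢p   = chargeFromLeft (swapSides th) (subst (Big G T ψ) b≡y bb)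
    where
    open Through th
    p≢y : p ≢ y
    p≢y refl = disjoint (here refl , here refl)
    b≡y : b ≡ y
    b≡y = ≡.sym (small-degree≤2 st (Linked.head linkedˡ) (Linked.head linkedʳ) tb p≢y (≢-sym b≢p))

  chargeOf : ∀ {t} → OnPathBetweenBig G T ψ t × AdjToBig G T ψ t → Charge t
  chargeOf {t} (on-path , _ , bb , tb) with big? t
  ... | yes bt = chargeFirst bb (sym T tb) (arrive bt) (adj⇒≢ {T} (sym T tb))
  ... | no st with on-path
  ...   | _ , _ , _ , bb₁ , bb₂ , _ , path , t∈ps with pathThrough path bb₁ bb₂ st t∈ps
  ...     | _ , _ , th = smallCharge st bb tb th

lemma2 : (G T : Graph) (ψ : V G → V T) →
    TwoConnected G → Cactus T → ContractsVia G T ψ →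
    (B : List (V T)) → Unique B →
    (∀ t → Big G T ψ t → t ∈ B) → All (Big G T ψ) B →
    (L : List (V T)) → Unique L →
    All (λ t → OnPathBetweenBig G T ψ t × AdjToBig G T ψ t) L →
    length L ≤ 4 * length B
lemma2 G T ψ tc cactus con B _ B-complete _ L uL onPath-adjBig = begin
  length L          ≡⟨ ≡.sym (length-reduce key charges) ⟩
  length keys       ≤⟨ length≤4*length _≟ᶠ_ (cactus⇒atMostTwoArms cactus)
                         (All-reduce key (λ c → B-complete _ (Charge.big c) , arm c) charges)
                         (Unique-reduce key key-injective uL charges) ⟩
  4 * length B      ∎
  where
  open ≤-Reasoning
  root : V T
  root = ψ (fromℕ< (≤-trans (s≤s z≤n) (proj₁ tc)))

  open Charging G T ψ tc cactus con root

  charges : All Charge L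
  charges = All.map chargeOf onPath-adjBig

  keys : List (V T × V T × Bool)
  keys = reduce key charges
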